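{- If $\mathcal{C}$ is a graph class of bounded expansion, then there is a graph class $\mathcal{C}_1$ of bounded expansion such that every line graph of a graph from $\mathcal{C}$ is an induced subgraph of $H^2$ for some $H\in\mathcal{C}_1$.
   Context: All graphs are finite and simple. A class $\mathcal{C}$ of graphs has bounded expansion if for every integer $r\ge 0$ there is a constant $c(r)$ such that every graph $H$ that is a depth-$r$ minor of a graph in $\mathcal{C}$ (obtained from a subgraph by contracting pairwise disjoint connected subgraphs of radius at most $r$) satisfies $|E(H)|\le c(r)|V(H)|$. The line graph of $G$ has vertex set $E(G)$, two edges adjacent iff they share an endpoint. The second power $H^2$ of a graph $H$ has vertex set $V(H)$, with distinct $u,v$ adjacent iff their distance in $H$ is at most $2$. -}

module Defs where

open import Data.Nat using (ℕ; zero; suc; _+_; _*_; _≤_; _<_)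
open import Data.Fin using (Fin; toℕ) renaming (zero to fzero; suc to fsuc)
open import Data.Bool using (Bool; true; false; _∧_; if_then_else_)
open import Data.Nat using (_<ᵇ_)
open import Data.Product using (Σ; ∃; _×_; _,_)
open import Data.Sum using (_⊎_)
open import Relation.Binary.PropositionalEquality using (_≡_; _≢_)
open import Function.Bundles using (_⇔_)

record Graph : Set where
  field
    n     : ℕ
    adj   : Fin n → Fin n → Bool
    sym   : ∀ u v → adj u v ≡ adj v u
    irrefl : ∀ u → adj u u ≡ false
open Graph public

∣V∣ : Graph → ℕ
∣V∣ G = n G

sumFin : (m : ℕ) → (Fin m → ℕ) → ℕ
sumFin zero    f = 0
sumFin (suc m) f = f fzero + sumFin m (λ i → f (fsuc i))

∣E∣ : Graph → ℕ
∣E∣ G = sumFin (n G) (λ i → sumFin (n G) (λ j →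
          if (toℕ j <ᵇ toℕ i) ∧ adj G i j then 1 else 0))

Class : Set₁
Class = Graph → Set

data WalkIn (G : Graph) (S : Fin (n G) → Bool) : ℕ → Fin (n G) → Fin (n G) → Set where
  here : ∀ {k a} → S a ≡ true → WalkIn G S k a a
  step : ∀ {k a b c} → S a ≡ true → adj G a b ≡ true →
         WalkIn G S k b c → WalkIn G S (suc k) a c

-- H is a depth-r minor of G: there are pairwise disjoint branch sets
-- B_u ⊆ V(G) (u ∈ V(H)), each with a centre from which every vertex of B_u
-- is reachable within G[B_u] by a path of length ≤ r (so B_u is connected
-- of radius ≤ r), and for every edge uv of H some edge of G joins B_u and B_v.
-- (Equivalently: H is obtained from a subgraph of G by contracting pairwise
-- disjoint connected subgraphs of radius ≤ r.)
record DepthMinor (r : ℕ) (H G : Graph) : Set where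
  field
    branch   : Fin (n H) → Fin (n G) → Bool
    centre   : Fin (n H) → Fin (n G)
    disjoint : ∀ u v x → branch u x ≡ true → branch v x ≡ true → u ≡ v
    radius   : ∀ u x → branch u x ≡ true → WalkIn G (branch u) r (centre u) x
    centreIn : ∀ u → branch u (centre u) ≡ true
    edges    : ∀ u v → adj H u v ≡ true →
               Σ (Fin (n G)) λ x → Σ (Fin (n G)) λ y →
                 branch u x ≡ true × branch v y ≡ true × adj G x y ≡ true

BoundedExpansion : Class → Set
BoundedExpansion 𝒞 = ∀ (r : ℕ) → Σ ℕ λ c →
  ∀ (G H : Graph) → 𝒞 G → DepthMinor r H G → ∣E∣ H ≤ c * ∣V∣ H

Edge : Graph → Set
Edge G = Σ (Fin (n G)) λ i → Σ (Fin (n G)) λ j → (toℕ i < toℕ j) × (adj G i j ≡ true)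

endpoint₁ endpoint₂ : ∀ {G} → Edge G → Fin (n G)
endpoint₁ (i , _ , _) = i
endpoint₂ (_ , j , _) = j

Incident : ∀ {G} → Edge G → Fin (n G) → Set
Incident {G} e x = (endpoint₁ {G} e ≡ x) ⊎ (endpoint₂ {G} e ≡ x)

LineAdj : (G : Graph) → Edge G → Edge G → Set
LineAdj G e f = (e ≢ f) × Σ (Fin (n G)) λ x → Incident {G} e x × Incident {G} f x

SquareAdj : (H : Graph) → Fin (n H) → Fin (n H) → Set
SquareAdj H u v = (u ≢ v) ×
  ((adj H u v ≡ true) ⊎ Σ (Fin (n H)) λ w → (adj H u w ≡ true) × (adj H w v ≡ true))

record InducedSubgraph (V W : Set) (R : V → V → Set) (S : W → W → Set) : Set where
  field
    f         : V → W
    injective : ∀ x y → f x ≡ f y → x ≡ y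
    preserves : ∀ x y → R x y ⇔ S (f x) (f y)

-- Take for 𝒞₁ the 1-subdivisions of the graphs in 𝒞 (here with an extra
-- isolated vertex for each non-adjacent pair). Two subdivision vertices are
-- at distance 2 exactly when the corresponding edges share an endpoint, so
-- L(G) is induced in the square of the subdivision of G.
--
-- Let M be a depth-r minor of a subdivision of G. A branch set containing no
-- original vertex of G is a single subdivision vertex, and the vertex of M
-- it represents has degree at most 2; delete it and recurse. Otherwise every
-- branch set meets V(G): restricting the branch sets to V(G) exhibits M as a
-- depth-(r+1) minor of G, since a path of the subdivision between original
-- vertices shortcuts to a path of G, and a subdivision vertex in a branch set
-- has an original neighbour there. Hence ∣E(M)∣ ≤ (c(r+1) + 2)∣V(M)∣.

module Submission where

open import Algebra.Properties.CommutativeSemigroup using (interchange)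
open import Axiom.UniquenessOfIdentityProofs using (module Decidable⇒UIP)
open import Data.Bool using (Bool; true; false; _∧_; if_then_else_)
import Data.Bool.Properties as Bool
open import Data.Fin using (Fin; toℕ; punchIn) renaming (zero to fzero; suc to fsuc)
open import Data.Fin.Properties using (_≟_; any?; suc-injective; punchIn-injective; +↔⊎; *↔×)
open import Data.Nat using (ℕ; zero; suc; _+_; _*_; _≤_; _<_; z≤n; s≤s; _<ᵇ_)
open import Data.Nat.Properties
  using (_<?_; ≤-reflexive; ≤-trans; +-mono-≤; +-monoʳ-≤; +-monoˡ-≤; m≤n+m; m≤m+n;
         *-suc; *-monoˡ-≤; <-irrelevant; +-0-commutativeMonoid; +-commutativeSemigroup;
         module ≤-Reasoning)
open import Data.Product using (Σ; _×_; _,_; proj₁; proj₂)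
open import Data.Sum using (_⊎_; inj₁; inj₂; map₂)
open import Data.Sum.Function.Propositional using (_⊎-↔_)
open import Function using (_∘_; _↔_; Inverse; Equivalence; mk⇔)
open import Function.Definitions using (Injective)
open import Function.Properties.Inverse using (↔-refl; ↔-trans)
open import Relation.Binary.PropositionalEquality
  using (_≡_; _≢_; refl; trans; cong; cong₂; subst; module ≡-Reasoning)
  renaming (sym to ≡-sym)
open import Relation.Nullary using (¬_; yes; no; ¬?; contradiction)
open import Relation.Nullary.Decidable
  using (Dec; ⌊_⌋; toWitness; fromWitness; _×-dec_; _⊎-dec_; decidable-stable)

open import Algebra.Properties.CommutativeMonoid.Sum +-0-commutativeMonoid
  using (sum; sum-remove; ∑-distrib-+; sum-replicate-zero)

open import Defs

𝟙 : Bool → ℕ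
𝟙 b = if b then 1 else 0

sumFin≡sum : ∀ m (f : Fin m → ℕ) → sumFin m f ≡ sum f
sumFin≡sum zero    f = refl
sumFin≡sum (suc m) f = cong (f fzero +_) (sumFin≡sum m (f ∘ fsuc))

sumFin-cong : ∀ m {f g : Fin m → ℕ} → (∀ i → f i ≡ g i) → sumFin m f ≡ sumFin m g
sumFin-cong zero    f≗g = refl
sumFin-cong (suc m) f≗g = cong₂ _+_ (f≗g fzero) (sumFin-cong m (f≗g ∘ fsuc))

sumFin-mono-≤ : ∀ m {f g : Fin m → ℕ} → (∀ i → f i ≤ g i) → sumFin m f ≤ sumFin m g
sumFin-mono-≤ zero    f≤g = z≤n
sumFin-mono-≤ (suc m) f≤g = +-mono-≤ (f≤g fzero) (sumFin-mono-≤ m (f≤g ∘ fsuc))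

sumFin-zero : ∀ m → sumFin m (λ _ → 0) ≡ 0
sumFin-zero m = trans (sumFin≡sum m _) (sum-replicate-zero m)

sumFin-+ : ∀ m (f g : Fin m → ℕ) → sumFin m (λ i → f i + g i) ≡ sumFin m f + sumFin m g
sumFin-+ m f g = begin
  sumFin m (λ i → f i + g i) ≡⟨ sumFin≡sum m _ ⟩
  sum (λ i → f i + g i)      ≡⟨ ∑-distrib-+ f g ⟩
  sum f + sum g              ≡⟨ ≡-sym (cong₂ _+_ (sumFin≡sum m f) (sumFin≡sum m g)) ⟩
  sumFin m f + sumFin m g    ∎
  where open ≡-Reasoning

sumFin-punchIn : ∀ m (f : Fin (suc m) → ℕ) v → sumFin (suc m) f ≡ f v + sumFin m (f ∘ punchIn v)
sumFin-punchIn m f v = begin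
  sumFin (suc m) f              ≡⟨ sumFin≡sum (suc m) f ⟩
  sum f                         ≡⟨ sum-remove {i = v} f ⟩
  f v + sum (f ∘ punchIn v)     ≡⟨ ≡-sym (cong (f v +_) (sumFin≡sum m _)) ⟩
  f v + sumFin m (f ∘ punchIn v) ∎
  where open ≡-Reasoning

sumFin-𝟙-≤-1 : ∀ m (P : Fin m → Bool) → (∀ u w → P u ≡ true → P w ≡ true → u ≡ w) →
               sumFin m (𝟙 ∘ P) ≤ 1
sumFin-𝟙-≤-1 zero    P unique = z≤n
sumFin-𝟙-≤-1 (suc m) P unique with P fzero in P0
... | false = sumFin-𝟙-≤-1 m (P ∘ fsuc) λ u w Pu Pw → suc-injective (unique _ _ Pu Pw)
... | true = ≤-reflexive (cong suc (trans (sumFin-cong m rest-false) (sumFin-zero m)))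
  where
  rest-false : ∀ u → 𝟙 (P (fsuc u)) ≡ 0
  rest-false u with P (fsuc u) in Pu
  ... | false = refl
  ... | true with unique fzero (fsuc u) P0 Pu
  ...   | ()

Adjacency : ℕ → Set
Adjacency k = Fin k → Fin k → Bool

-- ∣E∣ G unfolds to edgeCount (adj G).
edgeCount : ∀ {k} → Adjacency k → ℕ
edgeCount {k} a = sumFin k (λ i → sumFin k (λ j → 𝟙 ((toℕ j <ᵇ toℕ i) ∧ a i j)))

degree : ∀ {k} → Adjacency k → Fin k → ℕ
degree {k} a v = sumFin k (λ u → 𝟙 (a v u))

edgeCount-suc : ∀ {m} (a : Adjacency (suc m)) →
  edgeCount a ≡ sumFin m (λ i → 𝟙 (a (fsuc i) fzero)) + edgeCount (λ i j → a (fsuc i) (fsuc j))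
edgeCount-suc {m} a rewrite sumFin-zero m = sumFin-+ m (λ i → 𝟙 (a (fsuc i) fzero)) _

edgeCount-punchIn : ∀ {m} (a : Adjacency (suc m)) → (∀ u v → a u v ≡ a v u) → ∀ v →
  edgeCount a ≤ degree a v + edgeCount (λ i j → a (punchIn v i) (punchIn v j))
edgeCount-punchIn {m} a a-sym fzero rewrite edgeCount-suc a =
  +-monoˡ-≤ _ (≤-trans (≤-reflexive (sumFin-cong m (λ i → cong 𝟙 (a-sym (fsuc i) fzero))))
                       (m≤n+m _ (𝟙 (a fzero fzero))))
edgeCount-punchIn {suc m} a a-sym (fsuc v) = begin
  edgeCount a                                   ≡⟨ edgeCount-suc a ⟩
  sumFin (suc m) (λ i → 𝟙 (a (fsuc i) fzero)) + edgeCount a⁺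
    ≡⟨ cong (_+ edgeCount a⁺) (sumFin-punchIn m (λ i → 𝟙 (a (fsuc i) fzero)) v) ⟩
  (x + y) + edgeCount a⁺                        ≤⟨ +-monoʳ-≤ (x + y) (edgeCount-punchIn a⁺ a⁺-sym v) ⟩
  (x + y) + (degree a⁺ v + edgeCount a⁺∖v)      ≡⟨ interchange +-commutativeSemigroup x y _ _ ⟩
  (x + degree a⁺ v) + (y + edgeCount a⁺∖v)      ≡⟨ cong (x + degree a⁺ v +_) (≡-sym (edgeCount-suc a∖v)) ⟩
  degree a (fsuc v) + edgeCount a∖v             ∎
  where
  open ≤-Reasoning
  a⁺ : Adjacency (suc m)
  a⁺ i j = a (fsuc i) (fsuc j)
  a⁺-sym : ∀ u w → a⁺ u w ≡ a⁺ w u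
  a⁺-sym u w = a-sym (fsuc u) (fsuc w)
  a⁺∖v : Adjacency m
  a⁺∖v i j = a⁺ (punchIn v i) (punchIn v j)
  a∖v : Adjacency (suc m)
  a∖v i j = a (punchIn (fsuc v) i) (punchIn (fsuc v) j)
  x y : ℕ
  x = 𝟙 (a (fsuc v) fzero)
  y = sumFin m (λ i → 𝟙 (a (fsuc (punchIn v i)) fzero))

adjacent-distinct : ∀ (G : Graph) {u v} → adj G u v ≡ true → u ≢ v
adjacent-distinct G {u} uv refl = contradiction (trans (≡-sym uv) (irrefl G u)) λ ()

pullback : (G : Graph) {m : ℕ} → (Fin m → Fin (n G)) → Graph
pullback G {m} σ = record
  { n      = m
  ; adj    = λ u v → adj G (σ u) (σ v)
  ; sym    = λ u v → Graph.sym G (σ u) (σ v)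
  ; irrefl = λ u → irrefl G (σ u)
  }

module _ (P : Graph → Set)
         (P-pullback : ∀ G {m} (σ : Fin m → Fin (n G)) → Injective _≡_ _≡_ σ → P G → P (pullback G σ))
         (c d : ℕ)
         (degenerate-or-sparse : ∀ G → P G →
            (Σ (Fin (n G)) λ v → degree (adj G) v ≤ d) ⊎ ∣E∣ G ≤ c * ∣V∣ G)
  where

  ∣E∣≤[c+d]*∣V∣ : ∀ G → P G → ∣E∣ G ≤ (c + d) * ∣V∣ G
  ∣E∣≤[c+d]*∣V∣ G = go (n G) G refl
    where
    -- m makes the recursion structural: G∖v is not a subterm of G.
    go : ∀ m G → n G ≡ m → P G → ∣E∣ G ≤ (c + d) * ∣V∣ G
    go zero    record { n = zero }     refl PG = z≤n
    go (suc m) G@record { n = .(suc m) } refl PG with degenerate-or-sparse G PG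
    ... | inj₂ sparse = ≤-trans sparse (*-monoˡ-≤ (suc m) (m≤m+n c d))
    ... | inj₁ (v , deg≤d) = begin
      ∣E∣ G                                ≤⟨ edgeCount-punchIn (adj G) (Graph.sym G) v ⟩
      degree (adj G) v + ∣E∣ G∖v           ≤⟨ +-mono-≤ deg≤d (go m G∖v refl PG∖v) ⟩
      d + (c + d) * m                      ≤⟨ +-monoˡ-≤ _ (m≤n+m d c) ⟩
      (c + d) + (c + d) * m                ≡⟨ ≡-sym (*-suc (c + d) m) ⟩
      (c + d) * suc m                      ∎
      where
      open ≤-Reasoning
      G∖v : Graph
      G∖v = pullback G (punchIn v)
      PG∖v : P G∖v
      PG∖v = P-pullback G (punchIn v) (punchIn-injective v _ _) PG

DepthMinor-pullback : ∀ {r H G m} (σ : Fin m → Fin (n H)) → Injective _≡_ _≡_ σ →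
                      DepthMinor r H G → DepthMinor r (pullback H σ) G
DepthMinor-pullback σ σ-injective D = record
  { branch   = branch ∘ σ
  ; centre   = centre ∘ σ
  ; disjoint = λ u v x Bu Bv → σ-injective (disjoint (σ u) (σ v) x Bu Bv)
  ; radius   = radius ∘ σ
  ; centreIn = centreIn ∘ σ
  ; edges    = λ u v → edges (σ u) (σ v)
  }
  where open DepthMinor D

module _ {r : ℕ} {H G : Graph} (D : DepthMinor r H G) where
  open DepthMinor D

  degree-≤-2 : ∀ v x y → (∀ u → adj H v u ≡ true → branch u x ≡ true ⊎ branch u y ≡ true) →
               degree (adj H) v ≤ 2
  degree-≤-2 v x y hits = begin
    degree (adj H) v                                 ≤⟨ sumFin-mono-≤ (n H) count-hits ⟩
    sumFin (n H) (λ u → 𝟙 (branch u x) + 𝟙 (branch u y)) ≡⟨ sumFin-+ (n H) _ _ ⟩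
    sumFin (n H) (𝟙 ∘ λ u → branch u x) + sumFin (n H) (𝟙 ∘ λ u → branch u y)
      ≤⟨ +-mono-≤ (at-most-one x) (at-most-one y) ⟩
    2                                                ∎
    where
    open ≤-Reasoning
    at-most-one : ∀ z → sumFin (n H) (𝟙 ∘ λ u → branch u z) ≤ 1
    at-most-one z = sumFin-𝟙-≤-1 (n H) (λ u → branch u z) (λ u w → disjoint u w z)
    count-hits : ∀ u → 𝟙 (adj H v u) ≤ 𝟙 (branch u x) + 𝟙 (branch u y)
    count-hits u with adj H v u in vu
    ... | false = z≤n
    ... | true with hits u vu
    ...   | inj₁ Bx rewrite Bx = s≤s z≤n
    ...   | inj₂ By rewrite By = m≤n+m 1 (𝟙 (branch u x))

module _ {G : Graph} {B : Fin (n G) → Bool} where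

  walkIn-start : ∀ {k a b} → WalkIn G B k a b → B a ≡ true
  walkIn-start (here Ba)     = Ba
  walkIn-start (step Ba _ _) = Ba

  walkIn-suc : ∀ {k a b} → WalkIn G B k a b → WalkIn G B (suc k) a b
  walkIn-suc (here Ba)      = here Ba
  walkIn-suc (step Ba ab w) = step Ba ab (walkIn-suc w)

  walkIn-++ : ∀ {k l a b c} → WalkIn G B k a b → WalkIn G B l b c → WalkIn G B (k + l) a c
  walkIn-++ {zero}  (here _)       w′ = w′
  walkIn-++ {suc k} (here Ba)      w′ = walkIn-suc (walkIn-++ {k} (here Ba) w′)
  walkIn-++         (step Ba ab w) w′ = step Ba ab (walkIn-++ w w′)

  walkIn-firstEdge : ∀ {k a b} → WalkIn G B k a b → a ≢ b →
                     Σ (Fin (n G)) λ c → B c ≡ true × adj G a c ≡ true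
  walkIn-firstEdge (here _)       a≢a = contradiction refl a≢a
  walkIn-firstEdge (step _ ab w) _   = _ , walkIn-start w , ab

  walkIn-lastEdge : ∀ {k a b} → WalkIn G B k a b → a ≢ b →
                    Σ (Fin (n G)) λ c → B c ≡ true × adj G c b ≡ true
  walkIn-lastEdge (here _) a≢a = contradiction refl a≢a
  walkIn-lastEdge {b = b} (step {b = a′} Ba ab w) _ with a′ ≟ b
  ... | yes refl = _ , Ba , ab
  ... | no a′≢b  = walkIn-lastEdge w a′≢b

  neighbourIn : ∀ {k l c b o} → WalkIn G B k c b → WalkIn G B l c o → b ≢ o →
                Σ (Fin (n G)) λ y → B y ≡ true × adj G y b ≡ true
  neighbourIn {c = c} {b} c⇝b c⇝o b≢o with c ≟ b
  ... | no c≢b   = walkIn-lastEdge c⇝b c≢b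
  ... | yes refl with walkIn-firstEdge c⇝o b≢o
  ...   | y , By , by = y , By , trans (Graph.sym G y b) by

module Subdivision (G : Graph) where

  k : ℕ
  k = n G

  Pair : Set
  Pair = Fin k × Fin k

  Incidence : Fin k → Pair → Set
  Incidence x (i , j) = (toℕ i < toℕ j) × (adj G i j ≡ true) × ((i ≡ x) ⊎ (j ≡ x))

  incidence? : ∀ x p → Dec (Incidence x p)
  incidence? x (i , j) = toℕ i <? toℕ j ×-dec (adj G i j Bool.≟ true ×-dec (i ≟ x ⊎-dec j ≟ x))

  incidence-adjacent : ∀ {x y p} → Incidence x p → Incidence y p → x ≢ y → adj G x y ≡ true
  incidence-adjacent (_ , ij , inj₁ refl) (_ , _ , inj₂ refl) _   = ij
  incidence-adjacent (_ , ij , inj₂ refl) (_ , _ , inj₁ refl) _   = trans (Graph.sym G _ _) ij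
  incidence-adjacent (_ , _ , inj₁ refl) (_ , _ , inj₁ refl) x≢x = contradiction refl x≢x
  incidence-adjacent (_ , _ , inj₂ refl) (_ , _ , inj₂ refl) x≢x = contradiction refl x≢x

  Vertex : Set
  Vertex = Fin k ⊎ Pair

  code : Fin (k + k * k) ↔ Vertex
  code = ↔-trans +↔⊎ (↔-refl ⊎-↔ *↔×)

  open Inverse code using (to; from; strictlyInverseˡ; strictlyInverseʳ)

  adjᵛ : Vertex → Vertex → Bool
  adjᵛ (inj₁ x) (inj₂ p) = ⌊ incidence? x p ⌋
  adjᵛ (inj₂ p) (inj₁ x) = ⌊ incidence? x p ⌋
  adjᵛ (inj₁ _) (inj₁ _) = false
  adjᵛ (inj₂ _) (inj₂ _) = false

  adjᵛ-sym : ∀ v w → adjᵛ v w ≡ adjᵛ w v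
  adjᵛ-sym (inj₁ _) (inj₁ _) = refl
  adjᵛ-sym (inj₁ _) (inj₂ _) = refl
  adjᵛ-sym (inj₂ _) (inj₁ _) = refl
  adjᵛ-sym (inj₂ _) (inj₂ _) = refl

  adjᵛ-irrefl : ∀ v → adjᵛ v v ≡ false
  adjᵛ-irrefl (inj₁ _) = refl
  adjᵛ-irrefl (inj₂ _) = refl

  subdivision : Graph
  subdivision = record
    { n      = k + k * k
    ; adj    = λ a b → adjᵛ (to a) (to b)
    ; sym    = λ a b → adjᵛ-sym (to a) (to b)
    ; irrefl = adjᵛ-irrefl ∘ to
    }

  S : Graph
  S = subdivision

  orig : Fin k → Fin (n S)
  orig = from ∘ inj₁

  mid : Pair → Fin (n S)
  mid = from ∘ inj₂

  orig-injective : ∀ {x y} → orig x ≡ orig y → x ≡ y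
  orig-injective {x} {y} eq with trans (≡-sym (strictlyInverseˡ (inj₁ x)))
                                       (trans (cong to eq) (strictlyInverseˡ (inj₁ y)))
  ... | refl = refl

  mid-injective : ∀ {p q} → mid p ≡ mid q → p ≡ q
  mid-injective {p} {q} eq with trans (≡-sym (strictlyInverseˡ (inj₂ p)))
                                      (trans (cong to eq) (strictlyInverseˡ (inj₂ q)))
  ... | refl = refl

  orig≢mid : ∀ {x p} → orig x ≢ mid p
  orig≢mid {x} {p} eq with trans (≡-sym (strictlyInverseˡ (inj₁ x)))
                                 (trans (cong to eq) (strictlyInverseˡ (inj₂ p)))
  ... | ()

  orig-or-mid : ∀ a → (Σ (Fin k) λ x → a ≡ orig x) ⊎ (Σ Pair λ p → a ≡ mid p)
  orig-or-mid a with to a in eq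
  ... | inj₁ x = inj₁ (x , trans (≡-sym (strictlyInverseʳ a)) (cong from eq))
  ... | inj₂ p = inj₂ (p , trans (≡-sym (strictlyInverseʳ a)) (cong from eq))

  adj-orig-mid : ∀ x p → adj S (orig x) (mid p) ≡ ⌊ incidence? x p ⌋
  adj-orig-mid x p = cong₂ adjᵛ (strictlyInverseˡ (inj₁ x)) (strictlyInverseˡ (inj₂ p))

  adj-orig-orig : ∀ x y → adj S (orig x) (orig y) ≡ false
  adj-orig-orig x y = cong₂ adjᵛ (strictlyInverseˡ (inj₁ x)) (strictlyInverseˡ (inj₁ y))

  adj-mid-mid : ∀ p q → adj S (mid p) (mid q) ≡ false
  adj-mid-mid p q = cong₂ adjᵛ (strictlyInverseˡ (inj₂ p)) (strictlyInverseˡ (inj₂ q))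

  adjacent-orig-mid : ∀ {x p} → Incidence x p → adj S (orig x) (mid p) ≡ true
  adjacent-orig-mid {x} {p} inc =
    trans (adj-orig-mid x p) (Equivalence.to Bool.T-≡ (fromWitness inc))

  neighbour-of-mid : ∀ {a p} → adj S a (mid p) ≡ true → Σ (Fin k) λ x → a ≡ orig x × Incidence x p
  neighbour-of-mid {a} {p} ap with orig-or-mid a
  ... | inj₁ (x , refl) =
    x , refl , toWitness (Equivalence.from Bool.T-≡ (trans (≡-sym (adj-orig-mid x p)) ap))
  ... | inj₂ (q , refl) = contradiction (trans (≡-sym ap) (adj-mid-mid q p)) λ ()

  neighbour-of-orig : ∀ {a x} → adj S a (orig x) ≡ true → Σ Pair λ p → a ≡ mid p × Incidence x p
  neighbour-of-orig {a} {x} ax with orig-or-mid a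
  ... | inj₁ (y , refl) = contradiction (trans (≡-sym ax) (adj-orig-orig y x)) λ ()
  ... | inj₂ (p , refl) with neighbour-of-mid (trans (Graph.sym S (orig x) (mid p)) ax)
  ...   | _ , eq , inc rewrite orig-injective eq = p , refl , inc

  edgeVertex : Edge G → Fin (n S)
  edgeVertex (i , j , _) = mid (i , j)

  edgeVertex-injective : ∀ e f → edgeVertex e ≡ edgeVertex f → e ≡ f
  edgeVertex-injective (i , j , i<j , ij) (_ , _ , i<j′ , ij′) eq
    with mid-injective eq
  ... | refl with <-irrelevant i<j i<j′ | Decidable⇒UIP.≡-irrelevant Bool._≟_ ij ij′
  ...   | refl | refl = refl

  lineGraph⊆square : InducedSubgraph (Edge G) (Fin (n S)) (LineAdj G) (SquareAdj S)
  lineGraph⊆square = record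
    { f         = edgeVertex
    ; injective = edgeVertex-injective
    ; preserves = λ e f → mk⇔ (to-square e f) (from-square e f)
    }
    where
    incidence-of : ∀ {x} (e : Edge G) → Incident {G} e x → Incidence x (endpoint₁ {G} e , endpoint₂ {G} e)
    incidence-of (_ , _ , i<j , ij) ex = i<j , ij , ex

    to-square : ∀ e f → LineAdj G e f → SquareAdj S (edgeVertex e) (edgeVertex f)
    to-square e f (e≢f , x , ex , fx) =
      (λ eq → e≢f (edgeVertex-injective e f eq)) ,
      inj₂ (orig x , trans (Graph.sym S _ _) (adjacent-orig-mid (incidence-of e ex))
                   , adjacent-orig-mid (incidence-of f fx))

    from-square : ∀ e f → SquareAdj S (edgeVertex e) (edgeVertex f) → LineAdj G e f
    from-square e f (_ , inj₁ ef) with neighbour-of-mid ef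
    ... | _ , eq , _ = contradiction (≡-sym eq) orig≢mid
    from-square e f (e≢f , inj₂ (w , ew , wf)) with neighbour-of-mid wf
    ... | x , refl , fx with neighbour-of-mid (trans (Graph.sym S _ _) ew)
    ...   | _ , eq , ex with orig-injective eq
    ...     | refl = (λ e≡f → e≢f (cong edgeVertex e≡f)) , x , proj₂ (proj₂ ex) , proj₂ (proj₂ fx)

  walkIn-within-mids : ∀ {B l a b} → ¬ (Σ (Fin k) λ x → B (orig x) ≡ true) → WalkIn S B l a b → a ≡ b
  walkIn-within-mids avoids (here _) = refl
  walkIn-within-mids avoids (step {a = a} {b = b} Ba ab b⇝c) with orig-or-mid a
  ... | inj₁ (x , refl) = contradiction (x , Ba) avoids
  ... | inj₂ (p , refl) with neighbour-of-mid (trans (Graph.sym S b (mid p)) ab)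
  ...   | x , refl , _ = contradiction (x , walkIn-start b⇝c) avoids

  -- Every second vertex of such a walk is a subdivision vertex, which is
  -- either skipped (when both its neighbours on the walk coincide) or
  -- replaced by the edge it subdivides.
  walkIn-desubdivide : ∀ {B l a b x y} → WalkIn S B l a b → a ≡ orig x → b ≡ orig y →
                       WalkIn G (B ∘ orig) l x y
  walkIn-desubdivide (here Bx) refl eq with orig-injective eq
  ... | refl = here Bx
  walkIn-desubdivide {x = x} (step {b = m} Bx xm m⇝b) refl b≡y
    with neighbour-of-orig (trans (Graph.sym S m (orig x)) xm)
  ... | p , refl , xp with m⇝b
  ...   | here _ = contradiction (≡-sym b≡y) orig≢mid
  ...   | step {b = c} _ mc c⇝b with neighbour-of-mid (trans (Graph.sym S c (mid p)) mc)
  ...     | z , refl , zp with x ≟ z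
  ...       | yes refl = walkIn-suc (walkIn-suc (walkIn-desubdivide c⇝b refl b≡y))
  ...       | no x≢z   = walkIn-suc (step Bx (incidence-adjacent xp zp x≢z) (walkIn-desubdivide c⇝b refl b≡y))

  module _ {r : ℕ} {M : Graph} (D : DepthMinor r M S) where
    open DepthMinor D

    MeetsG : Fin (n M) → Set
    MeetsG u = Σ (Fin k) λ x → branch u (orig x) ≡ true

    meetsG? : ∀ u → Dec (MeetsG u)
    meetsG? u = any? λ x → branch u (orig x) Bool.≟ true

    -- Such a branch set is the single subdivision vertex mid (i , j), so every
    -- neighbouring branch set contains orig i or orig j.
    degree-≤-2-if-¬MeetsG : ∀ v → ¬ MeetsG v → degree (adj M) v ≤ 2
    degree-≤-2-if-¬MeetsG v avoids with orig-or-mid (centre v)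
    ... | inj₁ (x , c≡x) = contradiction (x , subst (λ a → branch v a ≡ true) c≡x (centreIn v)) avoids
    ... | inj₂ ((i , j) , c≡ij) = degree-≤-2 D v (orig i) (orig j) hits
      where
      hits : ∀ u → adj M v u ≡ true → branch u (orig i) ≡ true ⊎ branch u (orig j) ≡ true
      hits u vu with edges v u vu
      ... | a , b , Ba , Bb , ab with trans (≡-sym (walkIn-within-mids avoids (radius v a Ba))) c≡ij
      ...   | refl with neighbour-of-mid (trans (Graph.sym S b (mid (i , j))) ab)
      ...     | z , refl , (_ , _ , inj₁ refl) = inj₁ Bb
      ...     | z , refl , (_ , _ , inj₂ refl) = inj₂ Bb

    module _ (meets : ∀ u → MeetsG u) where

      nearCentre : ∀ u → Σ (Fin k) λ y → branch u (orig y) ≡ true × WalkIn S (branch u) 1 (orig y) (centre u)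
      nearCentre u with orig-or-mid (centre u)
      ... | inj₁ (y , c≡y) = y , By , subst (λ a → WalkIn S (branch u) 1 a (centre u)) c≡y (here (centreIn u))
        where
        By : branch u (orig y) ≡ true
        By = subst (λ a → branch u a ≡ true) c≡y (centreIn u)
      ... | inj₂ (p , c≡p) with meets u
      ...   | o , Bo with neighbourIn (here {k = 0} (centreIn u)) (radius u (orig o) Bo)
                                      (λ c≡o → orig≢mid (trans (≡-sym c≡o) c≡p))
      ...     | a , Ba , ac with neighbour-of-mid (subst (λ c → adj S a c ≡ true) c≡p ac)
      ...       | y , refl , _ = y , Ba , step Ba ac (here (centreIn u))

      mid-neighbourIn : ∀ {u v x p} → u ≢ v → branch u (orig x) ≡ true → branch v (mid p) ≡ true →
                        Incidence x p → Σ (Fin k) λ z → branch v (orig z) ≡ true × adj G x z ≡ true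
      mid-neighbourIn {u} {v} {x} {p} u≢v Bx Bp xp with meets v
      ... | o , Bo with neighbourIn (radius v (mid p) Bp) (radius v (orig o) Bo) (λ p≡o → orig≢mid (≡-sym p≡o))
      ...   | a , Ba , ap with neighbour-of-mid ap
      ...     | z , refl , zp = z , Ba , incidence-adjacent xp zp x≢z
        where
        x≢z : x ≢ z
        x≢z refl = u≢v (disjoint u v (orig x) Bx Ba)

      edgesInG : ∀ u v → adj M u v ≡ true → Σ (Fin k) λ x → Σ (Fin k) λ y →
                 branch u (orig x) ≡ true × branch v (orig y) ≡ true × adj G x y ≡ true
      edgesInG u v uv with edges u v uv
      ... | a , b , Ba , Bb , ab with orig-or-mid a
      ...   | inj₁ (x , refl) with neighbour-of-orig (trans (Graph.sym S b (orig x)) ab)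
      ...     | p , refl , xp with mid-neighbourIn (adjacent-distinct M uv) Ba Bb xp
      ...       | y , By , xy = x , y , Ba , By , xy
      edgesInG u v uv | a , b , Ba , Bb , ab | inj₂ (p , refl) with neighbour-of-mid (trans (Graph.sym S b (mid p)) ab)
      ...     | y , refl , yp with mid-neighbourIn (adjacent-distinct M uv ∘ ≡-sym) Bb Ba yp
      ...       | x , Bx , yx = x , y , Bx , Bb , trans (Graph.sym G x y) yx

      minorOfG : DepthMinor (suc r) M G
      minorOfG = record
        { branch   = λ u x → branch u (orig x)
        ; centre   = proj₁ ∘ nearCentre
        ; disjoint = λ u v x → disjoint u v (orig x)
        ; radius   = λ u x Bx → walkIn-desubdivide (walkIn-++ (proj₂ (proj₂ (nearCentre u))) (radius u (orig x) Bx))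
                                                   refl refl
        ; centreIn = proj₁ ∘ proj₂ ∘ nearCentre
        ; edges    = edgesInG
        }

    degenerate-or-minorOfG : (Σ (Fin (n M)) λ v → degree (adj M) v ≤ 2) ⊎ DepthMinor (suc r) M G
    degenerate-or-minorOfG with any? (¬? ∘ meetsG?)
    ... | yes (v , avoids) = inj₁ (v , degree-≤-2-if-¬MeetsG v avoids)
    ... | no ¬avoids = inj₂ (minorOfG λ u → decidable-stable (meetsG? u) λ avoids → ¬avoids (u , avoids))

open Subdivision using (subdivision; lineGraph⊆square; degenerate-or-minorOfG)

Subdivisions : Class → Class
Subdivisions 𝒞 H = Σ Graph λ G → 𝒞 G × subdivision G ≡ H

Subdivisions-boundedExpansion : ∀ 𝒞 → BoundedExpansion 𝒞 → BoundedExpansion (Subdivisions 𝒞)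
Subdivisions-boundedExpansion 𝒞 expansion r = c + 2 , λ { _ M (G , 𝒞G , refl) →
  ∣E∣≤[c+d]*∣V∣ (λ M → DepthMinor r M (subdivision G)) (λ _ → DepthMinor-pullback) c 2
                (λ M D → map₂ (density G M 𝒞G) (degenerate-or-minorOfG G D)) M }
  where
  c : ℕ
  c = proj₁ (expansion (suc r))
  density : ∀ G M → 𝒞 G → DepthMinor (suc r) M G → ∣E∣ M ≤ c * ∣V∣ M
  density = proj₂ (expansion (suc r))

lemma4 : (𝒞 : Class) → BoundedExpansion 𝒞 →
    Σ Class λ 𝒞₁ → BoundedExpansion 𝒞₁ ×
      (∀ (G : Graph) → 𝒞 G → Σ Graph λ H → 𝒞₁ H ×
         InducedSubgraph (Edge G) (Fin (n H)) (LineAdj G) (SquareAdj H))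
lemma4 𝒞 expansion =
  Subdivisions 𝒞 , Subdivisions-boundedExpansion 𝒞 expansion ,
  λ G 𝒞G → subdivision G , (G , 𝒞G , refl) , lineGraph⊆square G
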